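{- Let $\mathsf X$ be $\mathsf W$ or $\mathsf W^*$, and let $\mathcal D$ be a finite set of formulas closed under subformulas and single negations with $\top\in\mathcal D$. Then the $\mathsf{ILX}$-structure $\mathfrak M=(W,R,\{S_w:w\in W\},\Vdash)$ for $\mathcal D$ is a generalized Veltman model, and for every $G\in\mathcal D$ and $w\in W$: $\mathfrak M,w\Vdash G$ if and only if $G\in w$.
   Context: Modal formulas are built from propositional variables, $\bot$, $\to$ and binary $\rhd$; $\Box A$ abbreviates $\neg A\rhd\bot$, $\Diamond A$ abbreviates $\neg\Box\neg A$. $\mathsf{IL}$ has as axioms all instances of classical tautologies and of: $\Box(A\to B)\to(\Box A\to\Box B)$; $\Box(\Box A\to A)\to\Box A$; $\Box(A\to B)\to A\rhd B$; $(A\rhd B)\wedge(B\rhd C)\to A\rhd C$; $(A\rhd C)\wedge(B\rhd C)\to A\vee B\rhd C$; $A\rhd B\to(\Diamond A\to\Diamond B)$; $\Diamond A\rhd A$; rules modus ponens and necessitation. $\mathsf{ILW}$ is $\mathsf{IL}$ plus all instances of $A\rhd B\to A\rhd B\wedge\Box\neg A$; $\mathsf{ILW^*}$ is $\mathsf{IL}$ plus all instances of $A\rhd B\to B\wedge\Box C\rhd B\wedge\Box C\wedge\Box\neg A$. Closed under single negations: $B\in\mathcal D\Rightarrow{\sim}B\in\mathcal D$, where ${\sim}\neg C=C$ and ${\sim}B=\neg B$ otherwise. For maximal $\mathsf{ILX}$-consistent sets (MCSs) $w,u$ and a set of formulas $S$: $w\prec_S u$ iff for every finite $S'\subseteq S$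 and every formula $A$, $A\rhd\bigvee_{G\in S'}\neg G\in w$ implies $\neg A\in u$ and $\Box\neg A\in u$ (empty disjunction is $\bot$); $w\prec u$ means $w\prec_\emptyset u$. The $\mathsf{ILX}$-structure for $\mathcal D$: $W$ = set of $\mathsf{ILX}$-MCSs $w$ such that $G\wedge\Box\neg G\in w$ for some $G\in\mathcal D$; $wRu$ iff $w\prec u$; writing $R[w]=\{x\in W:wRx\}$ and $\dot R[u]=R[u]\cup\{u\}$, $uS_wV$ iff $wRu$, $V\subseteq R[w]$, and either (a) $V\cap\dot R[u]\neq\emptyset$, or (b) for every set of formulas $S$ with $w\prec_S u$ there are $v\in V$ and $G\in\mathcal D\cap\bigcup\dot R[u]$ (i.e. $G\in\mathcal D$ belonging to $u$ or to some $R$-successor of $u$) with $w\prec_{S\cup\{\Box\neg G\}}v$; $w\Vdash p$ iff $p\in w$. A generalized Veltman model is $(W,R,\{S_w\},\Vdash)$ with $W\neq\emptyset$, $R$ transitive and conversely well-founded, and for each $w$: $S_w\subseteq R[w]\times(\mathcal P(R[w])\setminus\{\emptyset\})$; $wRu\Rightarrow uS_w\{u\}$; $uS_wV$ and $vS_wZ_v$ for all $v\in V$ imply $uS_w\bigcup_{v\in V}Z_v$; $wRuRv\Rightarrow uS_w\{v\}$; $uS_wV$, $V\subseteq Z\subseteq R[w]$ imply $uS_wZ$. Forcing is classical for Boolean connectives and $w\Vdash A\rhd B$ iff for every $u$ with $wRu$ and $u\Vdash A$ there is $V$ with $uS_wV$ and $v\Vdash B$ for all $v\in V$. -}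

module Defs where

open import Level using (Level; _⊔_; Lift) renaming (suc to lsuc; zero to lzero)
open import Data.Nat using (ℕ)
open import Data.Bool using (Bool; true; false; not; _∨_)
open import Data.List using (List; []; _∷_)
open import Data.List.Membership.Propositional using (_∈_)
open import Data.List.Relation.Unary.All using (All)
open import Data.Product using (Σ; ∃; ∃₂; _×_; _,_)
open import Data.Sum using (_⊎_)
open import Data.Empty using (⊥)
open import Relation.Nullary using (¬_)
open import Relation.Unary using (Pred)
open import Relation.Binary.PropositionalEquality using (_≡_)
open import Induction.WellFounded using (WellFounded)
open import Function.Bundles using (_⇔_)

infixr 4 _⇒_
infix 5 _▷_
infixr 6 _∨'_ _∧'_

data Fm : Set where
  var : ℕ → Fm
  ⊥'  : Fm
  _⇒_ : Fm → Fm → Fm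
  _▷_ : Fm → Fm → Fm

¬' : Fm → Fm
¬' A = A ⇒ ⊥'

⊤' : Fm
⊤' = ¬' ⊥'

_∨'_ : Fm → Fm → Fm
A ∨' B = ¬' A ⇒ B

_∧'_ : Fm → Fm → Fm
A ∧' B = ¬' (A ⇒ ¬' B)

□ : Fm → Fm
□ A = ¬' A ▷ ⊥'

◇ : Fm → Fm
◇ A = ¬' (□ (¬' A))

-- Instances of classical tautologies: formulas true under every Boolean
-- valuation of their maximal non-Boolean parts (variables and ▷-formulas).

eval : (Fm → Bool) → Fm → Bool
eval v (var p) = v (var p)
eval v ⊥' = false
eval v (A ⇒ B) = not (eval v A) ∨ eval v B
eval v (A ▷ B) = v (A ▷ B)

Tautology : Fm → Set
Tautology A = ∀ (v : Fm → Bool) → eval v A ≡ true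

data ExtX : Set where
  XW XWstar : ExtX

data ExtraAxiom : ExtX → Fm → Set where
  axW  : ∀ {A B} → ExtraAxiom XW ((A ▷ B) ⇒ (A ▷ (B ∧' □ (¬' A))))
  axW* : ∀ {A B C} →
         ExtraAxiom XWstar ((A ▷ B) ⇒ ((B ∧' □ C) ▷ ((B ∧' □ C) ∧' □ (¬' A))))

data Prf (X : ExtX) : Fm → Set where
  taut : ∀ {A} → Tautology A → Prf X A
  axK  : ∀ {A B} → Prf X (□ (A ⇒ B) ⇒ (□ A ⇒ □ B))
  axL  : ∀ {A} → Prf X (□ (□ A ⇒ A) ⇒ □ A)
  axJ1 : ∀ {A B} → Prf X (□ (A ⇒ B) ⇒ (A ▷ B))
  axJ2 : ∀ {A B C} → Prf X (((A ▷ B) ∧' (B ▷ C)) ⇒ (A ▷ C))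
  axJ3 : ∀ {A B C} → Prf X (((A ▷ C) ∧' (B ▷ C)) ⇒ ((A ∨' B) ▷ C))
  axJ4 : ∀ {A B} → Prf X ((A ▷ B) ⇒ (◇ A ⇒ ◇ B))
  axJ5 : ∀ {A} → Prf X (◇ A ▷ A)
  extra : ∀ {A} → ExtraAxiom X A → Prf X A
  mp   : ∀ {A B} → Prf X (A ⇒ B) → Prf X A → Prf X B
  nec  : ∀ {A} → Prf X A → Prf X (□ A)

conj : List Fm → Fm
conj [] = ⊤'
conj (A ∷ Δ) = A ∧' conj Δ

Consistent : ExtX → Pred Fm lzero → Set
Consistent X Γ = ∀ (Δ : List Fm) → All Γ Δ → ¬ Prf X (conj Δ ⇒ ⊥')

MaxCons : ExtX → Pred Fm lzero → Set₁
MaxCons X Γ = Consistent X Γ ×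
  (∀ (Δ : Pred Fm lzero) → (∀ A → Γ A → Δ A) → Consistent X Δ → ∀ A → Δ A → Γ A)

∼ : Fm → Fm
∼ (A ⇒ ⊥') = A
∼ B = ¬' B

SubClosed : List Fm → Set
SubClosed D = (∀ {A B} → (A ⇒ B) ∈ D → A ∈ D × B ∈ D) ×
              (∀ {A B} → (A ▷ B) ∈ D → A ∈ D × B ∈ D)

NegClosed : List Fm → Set
NegClosed D = ∀ {B} → B ∈ D → ∼ B ∈ D

disjNeg : List Fm → Fm
disjNeg [] = ⊥'
disjNeg (G ∷ l) = ¬' G ∨' disjNeg l

Prec : Pred Fm lzero → Pred Fm lzero → Pred Fm lzero → Set
Prec S w u = ∀ (S' : List Fm) → All S S' → ∀ A →
  w (A ▷ disjNeg S') → u (¬' A) × u (□ (¬' A))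

module GVM {a r s p : Level} (W : Set a) (R : W → W → Set r)
           (S : W → W → (W → Set a) → Set s) (val : W → ℕ → Set p) where

  record IsGVM : Set (lsuc a ⊔ r ⊔ s) where
    field
      inhabited : W
      R-trans   : ∀ {x y z} → R x y → R y z → R x z
      R-cwf     : WellFounded (λ x y → R y x)
      S-dom     : ∀ {w u V} → S w u V →
                  R w u × (∀ x → V x → R w x) × (∃ λ x → V x)
      S-refl    : ∀ {w u} → R w u → S w u (λ x → x ≡ u)
      S-trans   : ∀ {w u V} → S w u V →
                  (Z : (y : W) → V y → W → Set a) →
                  (∀ y (q : V y) → S w y (Z y q)) →
                  S w u (λ x → ∃₂ λ y (q : V y) → Z y q x)
      S-R       : ∀ {w u x} → R w u → R u x → S w u (λ y → y ≡ x)
      S-mono    : ∀ {w u V Z} → S w u V → (∀ x → V x → Z x) →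
                  (∀ x → Z x → R w x) → S w u Z

  _⊩_ : W → Fm → Set (lsuc a ⊔ r ⊔ s ⊔ p)
  w ⊩ var n = Lift (lsuc a ⊔ r ⊔ s ⊔ p) (val w n)
  w ⊩ ⊥' = Lift (lsuc a ⊔ r ⊔ s ⊔ p) ⊥
  w ⊩ (A ⇒ B) = w ⊩ A → w ⊩ B
  w ⊩ (A ▷ B) = ∀ u → R w u → u ⊩ A →
    Σ (W → Set a) λ V → S w u V × (∀ x → V x → x ⊩ B)

module Structure (X : ExtX) (D : List Fm) where

  record World : Set₁ where
    field
      set  : Pred Fm lzero
      mcs  : MaxCons X set
      root : ∃ λ G → G ∈ D × set (G ∧' □ (¬' G))
  open World public

  R : World → World → Set
  R w u = Prec (λ _ → ⊥) (set w) (set u)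

  Sw : World → World → (World → Set₁) → Set₁
  Sw w u V = R w u × (∀ x → V x → R w x) ×
    ((∃ λ x → V x × (x ≡ u ⊎ R u x)) ⊎
     (∀ (S : Pred Fm lzero) → Prec S (set w) (set u) →
        ∃ λ y → V y × ∃ λ G → G ∈ D × (set u G ⊎ ∃ λ x → R u x × set x G) ×
          Prec (λ A → S A ⊎ A ≡ □ (¬' G)) (set w) (set y)))

  val : World → ℕ → Set
  val w n = set w (var n)

  open GVM World R Sw val public

module Submission where

-- The key
-- step is an existence lemma: H ∧ □¬H extends to an MCS u with w ≺_Q u unless
-- H ▷ ⋁{¬G : G ∈ T} ∈ w for a finite T ⊆ Q.  Two instances of it produce the
-- successors needed in the truth lemma for ▷.  Finally the frame conditions
-- of a generalized Veltman model are checked: transitivity of ≺, converse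
-- well-foundedness (each R-step boxes a new formula of the finite set D), and
-- the conditions on S_w, transitivity of S_w being the only involved one.

open import Defs
open import Level using (Lift; lift; lower) renaming (zero to lzero; suc to lsuc)
open import Data.Bool using (Bool; true; false; not; _∨_)
open import Data.Nat using (ℕ; zero; suc; _+_; _<_; _≤_; _⊔_; _≤′_; ≤′-refl; ≤′-step; s≤s)
open import Data.Nat.Properties
  using (+-suc; +-identityʳ; suc-injective; ≤⇒≤′; m≤m⊔n; m≤n⊔m; ≤-trans; ≤-refl)
open import Data.List using (List; []; _∷_; _++_; length)
open import Data.List.Properties using (length-removeAt′)
open import Data.List.Membership.Propositional using (_∈_)
open import Data.List.Relation.Unary.Any using (here; there; index; _─_)
open import Data.List.Relation.Unary.All using (All; []; _∷_)
import Data.List.Relation.Unary.All as All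
open import Data.List.Relation.Unary.All.Properties using (++⁺; ++⁻ˡ; ++⁻ʳ)
open import Data.Product using (Σ; ∃; ∃₂; _×_; _,_; proj₁; proj₂; uncurry)
open import Data.Sum using (_⊎_; inj₁; inj₂)
import Data.Sum as Sum
open import Data.Empty using (⊥; ⊥-elim)
open import Function using (_∘_)
open import Function.Bundles using (_⇔_; mk⇔; module Equivalence)
open import Induction.WellFounded using (WellFounded; Acc; acc)
open import Relation.Nullary using (¬_)
open import Relation.Unary using (Pred; ∅; _⊆_)
open import Relation.Binary.PropositionalEquality
  using (_≡_; _≢_; refl; sym; trans; subst; cong; cong₂; module ≡-Reasoning)

variable
  X : ExtX
  A B C : Fm
  L T : List Fm
  S : Pred Fm lzero
  v : Fm → Bool

-- A formula holds under a valuation.  Wrapping the equation in a record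
-- makes 'Holds v A' injective in A, so the rules below infer their formulas.
record Holds (v : Fm → Bool) (A : Fm) : Set where
  constructor ⟨_⟩
  field holds : eval v A ≡ true
open Holds

⇒-intro : (Holds v A → Holds v B) → Holds v (A ⇒ B)
⇒-intro {v} {A} {B} f = ⟨ by-cases (eval v A) refl ⟩
  where
  by-cases : ∀ b → eval v A ≡ b → not b ∨ eval v B ≡ true
  by-cases false _ = refl
  by-cases true  a = holds (f ⟨ a ⟩)

⇒-elim : Holds v (A ⇒ B) → Holds v A → Holds v B
⇒-elim {v} {A} ⟨ h ⟩ ⟨ a ⟩ rewrite a = ⟨ h ⟩

⊥-fails : ¬ Holds v ⊥'
⊥-fails ⟨ () ⟩

bivalence : ∀ v A → Holds v A ⊎ ¬ Holds v A
bivalence v A with eval v A in e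
... | true  = inj₁ ⟨ e ⟩
... | false = inj₂ λ { ⟨ a ⟩ → true≢false (trans (sym a) e) }
  where
  true≢false : true ≢ false
  true≢false ()

¬-intro : (Holds v A → ⊥) → Holds v (¬' A)
¬-intro f = ⇒-intro λ a → ⊥-elim (f a)

¬-elim : Holds v (¬' A) → Holds v A → ⊥
¬-elim n a = ⊥-fails (⇒-elim n a)

¬¬-elim : Holds v (¬' (¬' A)) → Holds v A
¬¬-elim {v} {A} nna with bivalence v A
... | inj₁ a  = a
... | inj₂ na = ⊥-elim (¬-elim nna (¬-intro na))

¬¬-intro : Holds v A → Holds v (¬' (¬' A))
¬¬-intro a = ¬-intro λ na → ¬-elim na a

∧-intro : Holds v A → Holds v B → Holds v (A ∧' B)
∧-intro a b = ¬-intro λ f → ¬-elim (⇒-elim f a) b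

∧-elimˡ : Holds v (A ∧' B) → Holds v A
∧-elimˡ {v} {A} ab with bivalence v A
... | inj₁ a  = a
... | inj₂ na = ⊥-elim (¬-elim ab (⇒-intro λ a → ⊥-elim (na a)))

∧-elimʳ : Holds v (A ∧' B) → Holds v B
∧-elimʳ {v} {B = B} ab with bivalence v B
... | inj₁ b  = b
... | inj₂ nb = ⊥-elim (¬-elim ab (⇒-intro λ _ → ¬-intro nb))

∨-introˡ : Holds v A → Holds v (A ∨' B)
∨-introˡ a = ⇒-intro λ na → ⊥-elim (¬-elim na a)

∨-introʳ : Holds v B → Holds v (A ∨' B)
∨-introʳ b = ⇒-intro λ _ → b

∨-elim : {P : Set} → Holds v (A ∨' B) → (Holds v A → P) → (Holds v B → P) → P
∨-elim {v} {A} ab f g with bivalence v A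
... | inj₁ a  = f a
... | inj₂ na = g (⇒-elim ab (¬-intro na))

conj-intro : All (Holds v) L → Holds v (conj L)
conj-intro []       = ⟨ refl ⟩
conj-intro (a ∷ as) = ∧-intro a (conj-intro as)

conj-elim : Holds v (conj L) → All (Holds v) L
conj-elim {L = []}    _ = []
conj-elim {L = _ ∷ _} c = ∧-elimˡ c ∷ conj-elim (∧-elimʳ c)

_⊨_ : List Fm → Fm → Set
L ⊨ B = ∀ v → All (Holds v) L → Holds v B

derive : All (Prf X) L → L ⊨ B → Prf X B
derive []       ent = taut λ v → holds (ent v [])
derive (p ∷ ps) ent = mp (derive ps λ v hs → ⇒-intro λ a → ent v (a ∷ hs)) p

_∪[_] : Pred Fm lzero → Fm → Pred Fm lzero
Γ ∪[ B ] = λ Y → Γ Y ⊎ Y ≡ B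

split-extension : ∀ {Γ} → All (Γ ∪[ B ]) L → Σ (List Fm) λ P → All Γ P × (B ∷ P) ⊨ conj L
split-extension [] = [] , [] , λ _ _ → ⟨ refl ⟩
split-extension (inj₁ g ∷ ls) with split-extension ls
... | P , ps , ent = _ ∷ P , g ∷ ps , λ { v (b ∷ a ∷ hs) → ∧-intro a (ent v (b ∷ hs)) }
split-extension (inj₂ refl ∷ ls) with split-extension ls
... | P , ps , ent = P , ps , λ { v (b ∷ hs) → ∧-intro b (ent v (b ∷ hs)) }

extension-consistent : ∀ {Γ} → (∀ P → All Γ P → ¬ Prf X (conj P ⇒ ¬' B)) →
  Consistent X (Γ ∪[ B ])
extension-consistent noRefutation L ls refutation with split-extension ls
... | P , ps , ent = noRefutation P ps (derive (refutation ∷ []) λ { v (r ∷ []) →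
  ⇒-intro λ c → ¬-intro λ b → ¬-elim r (ent v (b ∷ conj-elim c)) })

module MCS {Γ : Pred Fm lzero} (m : MaxCons X Γ) where

  unrefuted : (∀ P → All Γ P → ¬ Prf X (conj P ⇒ ¬' B)) → Γ B
  unrefuted {B} noRefutation =
    proj₂ m (Γ ∪[ B ]) (λ _ → inj₁) (extension-consistent noRefutation) B (inj₂ refl)

  closed : All Γ L → Prf X (conj L ⇒ B) → Γ B
  closed {L} ls p = unrefuted λ P ps r → proj₁ m (L ++ P) (++⁺ ls ps)
    (derive (p ∷ r ∷ []) λ { v (p ∷ r ∷ []) → ¬-intro λ c →
      let cs = conj-elim c in
      ¬-elim (⇒-elim r (conj-intro (++⁻ʳ L cs))) (⇒-elim p (conj-intro (++⁻ˡ L cs))) })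

  theorem : Prf X B → Γ B
  theorem p = closed [] (derive (p ∷ []) λ { v (b ∷ []) → ⇒-intro λ _ → b })

  infer : All Γ L → L ⊨ B → Γ B
  infer ls ent = closed ls (derive [] λ v [] → ⇒-intro λ c → ent v (conj-elim c))

  apply : Prf X (A ⇒ B) → Γ A → Γ B
  apply p a = infer (a ∷ theorem p ∷ []) λ { v (a ∷ p ∷ []) → ⇒-elim p a }

  ∧-parts : Γ (A ∧' B) → Γ A × Γ B
  ∧-parts ab = apply (derive [] λ _ [] → ⇒-intro ∧-elimˡ) ab
             , apply (derive [] λ _ [] → ⇒-intro ∧-elimʳ) ab

  ¬⇒-parts : Γ (¬' (A ⇒ B)) → Γ A × Γ (¬' B)
  ¬⇒-parts n = infer (n ∷ []) (λ { v (n ∷ []) →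
                 ¬¬-elim (¬-intro λ na → ¬-elim n (⇒-intro λ a → ⊥-elim (¬-elim na a))) })
             , infer (n ∷ []) (λ { v (n ∷ []) → ¬-intro λ b → ¬-elim n (⇒-intro λ _ → b) })

  no-contradiction : Γ A → Γ (¬' A) → ⊥
  no-contradiction {A = A} a na = proj₁ m (A ∷ ¬' A ∷ []) (a ∷ na ∷ []) (derive [] λ v [] →
    ¬-intro λ c → ¬-elim (∧-elimˡ (∧-elimʳ c)) (∧-elimˡ c))

  no-⊥ : ¬ Γ ⊥'
  no-⊥ b = proj₁ m (⊥' ∷ []) (b ∷ []) (derive [] λ _ _ → ⇒-intro ∧-elimˡ)

  stable : ¬ ¬ Γ A → Γ A
  stable nna = unrefuted λ P ps r → nna λ a → no-contradiction a (closed ps r)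

  complete : ¬ Γ A → Γ (¬' A)
  complete na = unrefuted λ P ps r → na (closed ps (derive (r ∷ []) λ { v (r ∷ []) →
    ⇒-intro λ c → ¬¬-elim (⇒-elim r c) }))

□-mono : Prf X (A ⇒ B) → Prf X (□ A ⇒ □ B)
□-mono p = mp axK (nec p)

module ILReasoning {Γ : Pred Fm lzero} (m : MaxCons X Γ) where
  open MCS m

  ▷-theorem : Prf X (A ⇒ B) → Γ (A ▷ B)
  ▷-theorem p = theorem (mp axJ1 (nec p))

  ▷-trans : Γ (A ▷ B) → Γ (B ▷ C) → Γ (A ▷ C)
  ▷-trans ab bc = infer (ab ∷ bc ∷ theorem axJ2 ∷ []) λ { v (ab ∷ bc ∷ j2 ∷ []) →
    ⇒-elim j2 (∧-intro ab bc) }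

  ▷-∨ : Γ (A ▷ C) → Γ (B ▷ C) → Γ ((A ∨' B) ▷ C)
  ▷-∨ ac bc = infer (ac ∷ bc ∷ theorem axJ3 ∷ []) λ { v (ac ∷ bc ∷ j3 ∷ []) →
    ⇒-elim j3 (∧-intro ac bc) }

  ▷-weaken : Γ (A ▷ B) → Prf X (B ⇒ C) → Γ (A ▷ C)
  ▷-weaken ab p = ▷-trans ab (▷-theorem p)

  ◇-▷ : Γ (◇ A ▷ A)
  ◇-▷ = theorem axJ5

  -- A ▷ A ∧ □¬A: by Löb, a formula is interpretable in its "last" occurrence.
  ▷-löb : Γ (A ▷ (A ∧' □ (¬' A)))
  ▷-löb {A} =
    ▷-trans (▷-theorem lastOrLater) (▷-∨ (▷-theorem (derive [] λ _ [] → ⇒-intro λ h → h)) ◇-▷)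
    where
    H = A ∧' □ (¬' A)
    boxed : Prf X (□ (¬' H) ⇒ □ (□ (¬' A) ⇒ ¬' A))
    boxed = □-mono (derive [] λ _ [] → ⇒-intro λ nh → ⇒-intro λ b → ¬-intro λ a →
      ¬-elim nh (∧-intro a b))
    lastOrLater : Prf X (A ⇒ (H ∨' ◇ H))
    lastOrLater = derive (boxed ∷ axL ∷ []) λ { v (boxed ∷ löb ∷ []) →
      ⇒-intro λ a → ⇒-intro λ nh → ¬-intro λ bh →
        ¬-elim nh (∧-intro a (⇒-elim löb (⇒-elim boxed bh))) }

▷-W : ∀ {Γ} (m : MaxCons X Γ) → Γ (A ▷ B) → Γ (A ▷ (B ∧' □ (¬' A)))
▷-W {XW} m ab = MCS.apply m (extra axW) ab
▷-W {XWstar} {A} {B} m ab =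
  ▷-trans ab (▷-trans (▷-theorem addBox⊤) (▷-weaken (MCS.apply m (extra axW*) ab) dropBox⊤))
  where
  open ILReasoning m
  addBox⊤ : Prf XWstar (B ⇒ (B ∧' □ ⊤'))
  addBox⊤ = derive (nec (derive [] λ _ [] → ¬-intro ⊥-fails) ∷ []) λ { v (□⊤ ∷ []) →
    ⇒-intro λ b → ∧-intro b □⊤ }
  dropBox⊤ : Prf XWstar (((B ∧' □ ⊤') ∧' □ (¬' A)) ⇒ (B ∧' □ (¬' A)))
  dropBox⊤ = derive [] λ _ [] → ⇒-intro λ h → ∧-intro (∧-elimˡ (∧-elimˡ h)) (∧-elimʳ h)

-- Enumeration of ℕ × ℕ along the antidiagonals: (0,0), (0,1), (1,0), (0,2), ...
next : ℕ × ℕ → ℕ × ℕ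
next (i , suc j) = suc i , j
next (i , zero)  = zero , suc i

unpair : ℕ → ℕ × ℕ
unpair zero    = 0 , 0
unpair (suc n) = next (unpair n)

unpair-reaches : ∀ d i j → i + j ≡ d → ∃ λ n → unpair n ≡ (i , j)
unpair-reaches _       zero    zero    _  = 0 , refl
unpair-reaches zero    zero    (suc j) ()
unpair-reaches (suc d) zero    (suc j) eq
  with unpair-reaches d j 0 (trans (+-identityʳ j) (suc-injective eq))
... | n , e = suc n , cong next e
unpair-reaches d       (suc i) j       eq
  with unpair-reaches d i (suc j) (trans (+-suc i j) eq)
... | n , e = suc n , cong next e

unpair-surjective : ∀ i j → ∃ λ n → unpair n ≡ (i , j)
unpair-surjective i j = unpair-reaches (i + j) i j refl

-- Decoding natural numbers as formulas, with fuel bounding the nesting depth.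
-- A code k stands for the tagged pair unpair k: tag 0 is a variable, tags 1
-- and 2 are an implication and an interpretability formula whose components
-- are coded by the pair unpair m; anything else is ⊥.
mutual
  decode : ℕ → ℕ → Fm
  decode zero    k = ⊥'
  decode (suc f) k = node f (unpair k)

  node : ℕ → ℕ × ℕ → Fm
  node f (0 , m) = var m
  node f (1 , m) = binary f _⇒_ (unpair m)
  node f (2 , m) = binary f _▷_ (unpair m)
  node f _       = ⊥'

  binary : ℕ → (Fm → Fm → Fm) → ℕ × ℕ → Fm
  binary f op (a , b) = op (decode f a) (decode f b)

Coded : Fm → Set
Coded A = ∃₂ λ k f₀ → ∀ f → f₀ ≤ f → decode f k ≡ A

coded-binary : ∀ {A B} t op → (∀ f m → node f (t , m) ≡ binary f op (unpair m)) →
  Coded A → Coded B → Coded (op A B)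
coded-binary {A} {B} t op node-t (ka , fa , ha) (kb , fb , hb)
  with unpair-surjective ka kb
... | m , em with unpair-surjective t m
... | k , ek = k , suc (fa ⊔ fb) , λ { (suc f) (s≤s le) → begin
      node f (unpair k)          ≡⟨ cong (node f) ek ⟩
      node f (t , m)             ≡⟨ node-t f m ⟩
      binary f op (unpair m)     ≡⟨ cong (binary f op) em ⟩
      op (decode f ka) (decode f kb)
        ≡⟨ cong₂ op (ha f (≤-trans (m≤m⊔n fa fb) le)) (hb f (≤-trans (m≤n⊔m fa fb) le)) ⟩
      op A B                     ∎ }
  where open ≡-Reasoning

every-formula-coded : ∀ A → Coded A
every-formula-coded (var p) with unpair-surjective 0 p
... | k , e = k , 1 , λ { (suc f) _ → cong (node f) e }
every-formula-coded ⊥' with unpair-surjective 3 0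
... | k , e = k , 1 , λ { (suc f) _ → cong (node f) e }
every-formula-coded (A ⇒ B) =
  coded-binary 1 _⇒_ (λ _ _ → refl) (every-formula-coded A) (every-formula-coded B)
every-formula-coded (A ▷ B) =
  coded-binary 2 _▷_ (λ _ _ → refl) (every-formula-coded A) (every-formula-coded B)

enum : ℕ → Fm
enum n = uncurry decode (unpair n)

enum-surjective : ∀ A → ∃ λ n → enum n ≡ A
enum-surjective A with every-formula-coded A
... | k , f₀ , h with unpair-surjective f₀ k
... | n , e = n , trans (cong (uncurry decode) e) (h f₀ ≤-refl)

consistent-⊆ : ∀ {X} {P Q : Pred Fm lzero} → P ⊆ Q → Consistent X Q → Consistent X P
consistent-⊆ P⊆Q conQ L ps = conQ L (All.map P⊆Q ps)

module Lindenbaum {X : ExtX} (Γ : Pred Fm lzero) (con : Consistent X Γ) where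

  stage : ℕ → Pred Fm lzero
  stage zero      = Γ
  stage (suc n) Y = stage n Y ⊎ (Y ≡ enum n × Consistent X (stage n ∪[ enum n ]))

  Γ* : Pred Fm lzero
  Γ* Y = ∃ λ n → stage n Y

  stage-mono : ∀ {m n} → m ≤′ n → ∀ {Y} → stage m Y → stage n Y
  stage-mono ≤′-refl        s = s
  stage-mono (≤′-step m≤′n) s = inj₁ (stage-mono m≤′n s)

  old-or-added : ∀ n {L} → All (stage (suc n)) L →
    All (stage n) L ⊎ Consistent X (stage n ∪[ enum n ])
  old-or-added n [] = inj₁ []
  old-or-added n (inj₂ (_ , c) ∷ _) = inj₂ c
  old-or-added n (inj₁ s ∷ ss) with old-or-added n ss
  ... | inj₁ old = inj₁ (s ∷ old)
  ... | inj₂ c   = inj₂ c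

  stage-consistent : ∀ n → Consistent X (stage n)
  stage-consistent zero = con
  stage-consistent (suc n) L ls with old-or-added n ls
  ... | inj₁ old = stage-consistent n L old
  ... | inj₂ c   = consistent-⊆ forget c L ls
    where
    forget : ∀ {Y} → stage (suc n) Y → (stage n ∪[ enum n ]) Y
    forget (inj₁ s)       = inj₁ s
    forget (inj₂ (e , _)) = inj₂ e

  common-stage : ∀ {L} → All Γ* L → ∃ λ n → All (stage n) L
  common-stage [] = 0 , []
  common-stage ((k , s) ∷ ls) with common-stage ls
  ... | n , ss = k ⊔ n , stage-mono (≤⇒≤′ (m≤m⊔n k n)) s
                      ∷ All.map (stage-mono (≤⇒≤′ (m≤n⊔m k n))) ss

  Γ*-consistent : Consistent X Γ*
  Γ*-consistent L ls with common-stage ls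
  ... | n , ss = stage-consistent n L ss

  -- A formula consistent with Γ* was added at its stage of the enumeration.
  Γ*-maximal : ∀ Δ → (∀ A → Γ* A → Δ A) → Consistent X Δ → ∀ A → Δ A → Γ* A
  Γ*-maximal Δ Γ*⊆Δ conΔ A a with enum-surjective A
  ... | n , refl = suc n , inj₂ (refl , consistent-⊆ into-Δ conΔ)
    where
    into-Δ : ∀ {Y} → (stage n ∪[ enum n ]) Y → Δ Y
    into-Δ (inj₁ s)    = Γ*⊆Δ _ (n , s)
    into-Δ (inj₂ refl) = a

lindenbaum : ∀ {X} (Γ : Pred Fm lzero) → Consistent X Γ →
  Σ (Pred Fm lzero) λ Δ → MaxCons X Δ × Γ ⊆ Δ
lindenbaum Γ con = Γ* , (Γ*-consistent , Γ*-maximal) , λ g → 0 , g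
  where open Lindenbaum Γ con

disjNeg-++ˡ : ∀ {T'} → Holds v (disjNeg T) → Holds v (disjNeg (T ++ T'))
disjNeg-++ˡ {T = []}    h = ⊥-elim (⊥-fails h)
disjNeg-++ˡ {T = _ ∷ T} h = ∨-elim h ∨-introˡ λ h → ∨-introʳ (disjNeg-++ˡ {T = T} h)

disjNeg-++ʳ : ∀ {T'} → Holds v (disjNeg T') → Holds v (disjNeg (T ++ T'))
disjNeg-++ʳ {T = []}    h = h
disjNeg-++ʳ {T = _ ∷ T} h = ∨-introʳ (disjNeg-++ʳ {T = T} h)

disjNeg-∅ : All ∅ T → ¬ Holds v (disjNeg T)
disjNeg-∅ [] = ⊥-fails

drop-disjunct : All (S ∪[ C ]) T → Σ (List Fm) λ T' → All S T' × (disjNeg T ∷ C ∷ []) ⊨ disjNeg T'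
drop-disjunct [] = [] , [] , λ { v (h ∷ _ ∷ []) → h }
drop-disjunct (inj₁ s ∷ ss) with drop-disjunct ss
... | T' , ss' , ent = _ ∷ T' , s ∷ ss' , λ { v (h ∷ c ∷ []) →
  ∨-elim h ∨-introˡ λ h → ∨-introʳ (ent v (h ∷ c ∷ [])) }
drop-disjunct (inj₂ refl ∷ ss) with drop-disjunct ss
... | T' , ss' , ent = T' , ss' , λ { v (h ∷ c ∷ []) →
  ∨-elim h (λ nc → ⊥-elim (¬-elim nc c)) λ h → ent v (h ∷ c ∷ []) }

≺-antitone : ∀ {S₁ S₂ w u} → S₁ ⊆ S₂ → Prec S₂ w u → Prec S₁ w u
≺-antitone S₁⊆S₂ p S' ss = p S' (All.map S₁⊆S₂ ss)

≺-□¬ : ∀ {w u} → MaxCons X u → Prec ∅ w u → w (□ (¬' C)) → u (¬' C) × u (□ (¬' C))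
≺-□¬ {C = C} mu p b with p [] [] (¬' (¬' C)) b
... | a , c = apply ¬¬¬-elim a , apply (□-mono ¬¬¬-elim) c
  where
  open MCS mu
  ¬¬¬-elim : Prf _ (¬' (¬' (¬' C)) ⇒ ¬' C)
  ¬¬¬-elim = derive [] λ _ [] → ⇒-intro ¬¬-elim

≺-trans : ∀ {w u x} → MaxCons X x → Prec S w u → Prec ∅ u x → Prec S w x
≺-trans {u = u} mx p q S' ss A h = ≺-□¬ {w = u} mx q (proj₂ (p S' ss A h))

-- C is Q-refuted in w: C ▷ ⋁{¬G : G ∈ T} ∈ w for a finite T ⊆ Q.
-- By definition, w ≺_Q u says that u contains ¬C and □¬C for all such C.
Refuted : Pred Fm lzero → Pred Fm lzero → Fm → Set
Refuted w Q C = Σ (List Fm) λ T → All Q T × w (C ▷ disjNeg T)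

module Refutation {w : Pred Fm lzero} (mw : MaxCons X w) {Q : Pred Fm lzero} where
  open ILReasoning mw

  refuted-⊥ : Refuted w Q ⊥'
  refuted-⊥ = [] , [] , ▷-theorem (derive [] λ _ [] → ⇒-intro λ b → b)

  refuted-∨ : Refuted w Q A → Refuted w Q B → Refuted w Q (A ∨' B)
  refuted-∨ (T , ts , a) (T' , ts' , b) = T ++ T' , ++⁺ ts ts' ,
    ▷-∨ (▷-weaken a (derive [] λ _ [] → ⇒-intro (disjNeg-++ˡ {T = T})))
        (▷-weaken b (derive [] λ _ [] → ⇒-intro (disjNeg-++ʳ {T = T})))

  refuted-◇ : Refuted w Q A → Refuted w Q (◇ A)
  refuted-◇ (T , ts , a) = T , ts , ▷-trans ◇-▷ a

  refuted-▷ : w (A ▷ B) → Refuted w Q B → Refuted w Q A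
  refuted-▷ ab (T , ts , b) = T , ts , ▷-trans ab b

Successor : ExtX → Pred Fm lzero → Pred Fm lzero → Fm → Set₁
Successor X w Q H = Σ (Pred Fm lzero) λ u → MaxCons X u × u H × u (□ (¬' H)) × Prec Q w u

-- The existence lemma: an H-successor along Q exists unless H is Q-refuted.
-- It extends {H, □¬H} ∪ {¬C, □¬C : C Q-refuted} by Lindenbaum's lemma.
module Existence {w : Pred Fm lzero} (mw : MaxCons X w) (Q : Pred Fm lzero) (H : Fm) where
  open ILReasoning mw
  open Refutation mw {Q}

  Seed : Pred Fm lzero
  Seed Y = (Y ≡ H ⊎ Y ≡ □ (¬' H)) ⊎ Σ Fm λ C → Refuted w Q C × (Y ≡ ¬' C ⊎ Y ≡ □ (¬' C))

  seed-finite : ∀ {L} → All Seed L →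
    Σ Fm λ E → Refuted w Q E × (H ∷ □ (¬' H) ∷ ¬' E ∷ []) ⊨ conj L
  seed-finite [] = ⊥' , refuted-⊥ , λ _ _ → ¬-intro ⊥-fails
  seed-finite (s ∷ ss) with seed-finite ss
  ... | E , e , ent with s
  ... | inj₁ (inj₁ refl) = E , e , λ { v hs@(h ∷ _) → ∧-intro h (ent v hs) }
  ... | inj₁ (inj₂ refl) = E , e , λ { v hs@(_ ∷ b ∷ _) → ∧-intro b (ent v hs) }
  ... | inj₂ (C , c , inj₁ refl) = C ∨' E , refuted-∨ c e , λ { v (h ∷ b ∷ ne ∷ []) →
    ∧-intro (¬-intro λ x → ¬-elim ne (∨-introˡ x))
            (ent v (h ∷ b ∷ ¬-intro (λ x → ¬-elim ne (∨-introʳ x)) ∷ [])) }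
  ... | inj₂ (C , c , inj₂ refl) = ◇ C ∨' E , refuted-∨ (refuted-◇ c) e , λ { v (h ∷ b ∷ ne ∷ []) →
    ∧-intro (¬¬-elim (¬-intro λ x → ¬-elim ne (∨-introˡ x)))
            (ent v (h ∷ b ∷ ¬-intro (λ x → ¬-elim ne (∨-introʳ x)) ∷ [])) }

  -- An inconsistent seed makes H ∧ □¬H, hence (by Löb) H, refuted.
  seed-consistent : ¬ Refuted w Q H → Consistent X Seed
  seed-consistent unrefuted L ss inconsistent with seed-finite ss
  ... | E , e , ent = unrefuted (refuted-▷ ▷-löb (refuted-▷ (▷-theorem H∧□¬H⇒E) e))
    where
    H∧□¬H⇒E : Prf X ((H ∧' □ (¬' H)) ⇒ E)
    H∧□¬H⇒E = derive (inconsistent ∷ []) λ { v (i ∷ []) → ⇒-intro λ hb →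
      ¬¬-elim (¬-intro λ ne → ¬-elim i (ent v (∧-elimˡ hb ∷ ∧-elimʳ hb ∷ ne ∷ []))) }

  successor : ¬ Refuted w Q H → Successor X w Q H
  successor unrefuted with lindenbaum Seed (seed-consistent unrefuted)
  ... | u , mu , seed⊆u = u , mu , seed⊆u (inj₁ (inj₁ refl)) , seed⊆u (inj₁ (inj₂ refl)) ,
    λ T ts C c → seed⊆u (inj₂ (C , (T , ts , c) , inj₁ refl))
               , seed⊆u (inj₂ (C , (T , ts , c) , inj₂ refl))

¬▷-successor : ∀ {w} → MaxCons X w → w (¬' (A ▷ B)) → Successor X w (∅ ∪[ ¬' B ]) A
¬▷-successor {A = A} {B} mw nab =
  successor λ (T , ts , a) → no-contradiction (▷-weaken a (⋁¬T⇒B ts)) nab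
  where
  open MCS mw
  open ILReasoning mw
  open Existence mw (∅ ∪[ ¬' B ]) A
  ⋁¬T⇒B : ∀ {T} → All (∅ ∪[ ¬' B ]) T → Prf X (disjNeg T ⇒ B)
  ⋁¬T⇒B ts with drop-disjunct ts
  ... | T' , ts' , ent = derive [] λ v [] → ⇒-intro λ h →
    ¬¬-elim (¬-intro λ nb → disjNeg-∅ ts' (ent v (h ∷ nb ∷ [])))

-- If A ▷ B ∈ w and w ≺_S u with A ∈ u, then B has a successor y of w with
-- w ≺_{S ∪ {□¬A}} y.  This is where the principle W is used.
▷-successor : ∀ {w u} → MaxCons X w → MaxCons X u → w (A ▷ B) → Prec S w u → u A →
  Successor X w (S ∪[ □ (¬' A) ]) B
▷-successor {A = A} {B} {S} {w} {u} mw mu ab w≺u a =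
  successor λ (T , ts , b) → MCS.no-contradiction mu a (¬A∈u ts b)
  where
  open ILReasoning mw
  open Existence mw (S ∪[ □ (¬' A) ]) B
  -- B ▷ ⋁¬T gives A ▷ ⋁¬T ∧ □¬A, so A is S-refuted.
  ¬A∈u : ∀ {T} → All (S ∪[ □ (¬' A) ]) T → w (B ▷ disjNeg T) → u (¬' A)
  ¬A∈u ts b with drop-disjunct ts
  ... | T' , ts' , ent = proj₁ (w≺u T' ts' A (▷-weaken (▷-W mw (▷-trans ab b))
    (derive [] λ v [] → ⇒-intro λ h → ent v (∧-elimˡ h ∷ ∧-elimʳ h ∷ []))))

≺-excludes : ∀ {w x} → MaxCons X w → MaxCons X x → Prec (∅ ∪[ ¬' B ]) w x → ¬ x B
≺-excludes {B = B} mw mx p b = MCS.no-contradiction mx b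
  (proj₁ (p (¬' B ∷ []) (inj₂ refl ∷ []) B (ILReasoning.▷-theorem mw
    (derive [] λ _ [] → ⇒-intro λ b → ∨-introˡ (¬¬-intro b)))))

-- The valuation making every ▷-formula (hence every □-formula) true
-- validates every theorem, so ILX is consistent.
trivial : Fm → Bool
trivial (_ ▷ _) = true
trivial _       = false

trivially-sound : Prf X A → Holds trivial A
trivially-sound (taut t)     = ⟨ t trivial ⟩
trivially-sound axK          = ⇒-intro λ _ → ⇒-intro λ _ → ⟨ refl ⟩
trivially-sound axL          = ⇒-intro λ _ → ⟨ refl ⟩
trivially-sound axJ1         = ⇒-intro λ _ → ⟨ refl ⟩
trivially-sound axJ2         = ⇒-intro λ _ → ⟨ refl ⟩
trivially-sound axJ3         = ⇒-intro λ _ → ⟨ refl ⟩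
trivially-sound axJ4         = ⇒-intro λ _ → ⇒-intro λ ◇a → ⊥-elim (¬-elim ◇a ⟨ refl ⟩)
trivially-sound axJ5         = ⟨ refl ⟩
trivially-sound (extra axW)  = ⇒-intro λ _ → ⟨ refl ⟩
trivially-sound (extra axW*) = ⇒-intro λ _ → ⟨ refl ⟩
trivially-sound (mp p q)     = ⇒-elim (trivially-sound p) (trivially-sound q)
trivially-sound (nec p)      = ⟨ refl ⟩

trivially-consistent : ∀ {Γ : Pred Fm lzero} → (∀ {A} → Γ A → Holds trivial A) → Consistent X Γ
trivially-consistent valid L ls p =
  ⊥-fails (⇒-elim (trivially-sound p) (conj-intro (All.map valid ls)))

∈-─ : ∀ {x y : Fm} {xs} (p : x ∈ xs) → y ∈ xs → y ≡ x ⊎ y ∈ (xs ─ p)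
∈-─ (here refl) (here refl) = inj₁ refl
∈-─ (here _)    (there q)   = inj₂ q
∈-─ (there p)   (here refl) = inj₂ (here refl)
∈-─ (there p)   (there q)   = Sum.map₂ there (∈-─ p q)

module Canonical (X : ExtX) (D : List Fm) where
  open Structure X D

  world : (u : Pred Fm lzero) → MaxCons X u → ∀ {G} → G ∈ D → u G → u (□ (¬' G)) → World
  world u mu {G} g∈D g b = record
    { set  = u
    ; mcs  = mu
    ; root = G , g∈D , MCS.infer mu (g ∷ b ∷ []) λ { v (g ∷ b ∷ []) → ∧-intro g b }
    }

  root-parts : (u : World) → Σ Fm λ G → G ∈ D × set u G × set u (□ (¬' G))
  root-parts u with root u
  ... | G , g∈D , r = G , g∈D , MCS.∧-parts (mcs u) r

  inhabited : ⊤' ∈ D → World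
  inhabited ⊤∈D
    with lindenbaum (λ Y → Y ≡ ⊤' ∧' □ (¬' ⊤')) (trivially-consistent λ { refl → ⟨ refl ⟩ })
  ... | u , mu , seed⊆u = let ⊤ , □¬⊤ = MCS.∧-parts mu (seed⊆u refl) in world u mu ⊤∈D ⊤ □¬⊤

  R-trans : ∀ {x y z} → R x y → R y z → R x z
  R-trans {x} {y} {z} = ≺-trans {w = set x} {u = set y} (mcs z)

  R-□¬ : ∀ {w u C} → R w u → set w (□ (¬' C)) → set u (¬' C) × set u (□ (¬' C))
  R-□¬ {w} {u} = ≺-□¬ {w = set w} (mcs u)

  -- E covers w if every G ∈ D either has □¬G ∈ w or occurs in E.  An
  -- R-step boxes the root of the new world, which then leaves E.
  Covers : List Fm → World → Set
  Covers E w = ∀ {G} → G ∈ D → set w (□ (¬' G)) ⊎ G ∈ E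

  accessible : ∀ n E → length E < n → ∀ w → Covers E w → Acc (λ x y → R y x) w
  accessible (suc n) E (s≤s |E|≤n) w cover = acc λ {u} w≺u → step u w≺u (root-parts u)
    where
    step : ∀ u → R w u → (Σ Fm λ G → G ∈ D × set u G × set u (□ (¬' G))) → Acc (λ x y → R y x) u
    step u w≺u (G , g∈D , g , □¬g) with cover g∈D
    ... | inj₁ b   = ⊥-elim (MCS.no-contradiction (mcs u) g (proj₁ (R-□¬ {w} {u} w≺u b)))
    ... | inj₂ g∈E =
      accessible n (E ─ g∈E) (subst (_≤ n) (length-removeAt′ E (index g∈E)) |E|≤n) u cover′
      where
      cover′ : Covers (E ─ g∈E) u
      cover′ h∈D with cover h∈D
      ... | inj₁ b = inj₁ (proj₂ (R-□¬ {w} {u} w≺u b))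
      ... | inj₂ h∈E with ∈-─ g∈E h∈E
      ...   | inj₁ refl = inj₁ □¬g
      ...   | inj₂ h∈E′ = inj₂ h∈E′

  R-cwf : WellFounded (λ x y → R y x)
  R-cwf w = accessible (suc (length D)) D ≤-refl w inj₂

  InṘ : World → World → Set₁
  InṘ u x = x ≡ u ⊎ R u x

  Occurs : World → Fm → Set₁
  Occurs u G = set u G ⊎ ∃ λ x → R u x × set x G

  ClauseA : World → (World → Set₁) → Set₁
  ClauseA u V = ∃ λ x → V x × InṘ u x

  WitnessB : World → World → (World → Set₁) → Pred Fm lzero → Set₁
  WitnessB w u V S = ∃ λ y → V y × ∃ λ G → G ∈ D × Occurs u G × Prec (S ∪[ □ (¬' G) ]) (set w) (set y)

  ClauseB : World → World → (World → Set₁) → Set₁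
  ClauseB w u V = ∀ S → Prec S (set w) (set u) → WitnessB w u V S

  InṘ-trans : ∀ {u y z} → InṘ u y → InṘ y z → InṘ u z
  InṘ-trans (inj₁ refl) yz = yz
  InṘ-trans (inj₂ uy) (inj₁ refl) = inj₂ uy
  InṘ-trans {u} {y} {z} (inj₂ uy) (inj₂ yz) = inj₂ (R-trans {u} {y} {z} uy yz)

  Occurs-InṘ : ∀ {u y G} → InṘ u y → Occurs y G → Occurs u G
  Occurs-InṘ (inj₁ refl) occ = occ
  Occurs-InṘ {y = y} (inj₂ uy) (inj₁ g) = inj₂ (y , uy , g)
  Occurs-InṘ {u} {y} (inj₂ uy) (inj₂ (x , yx , g)) = inj₂ (x , R-trans {u} {y} {x} uy yx , g)

  ≺-InṘ : ∀ {S w u y} → InṘ u y → Prec S (set w) (set u) → Prec S (set w) (set y)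
  ≺-InṘ (inj₁ refl) p = p
  ≺-InṘ {w = w} {u} {y} (inj₂ uy) p = ≺-trans {w = set w} {u = set u} (mcs y) p uy

  S-dom : ∀ {w u V} → Sw w u V → R w u × (∀ x → V x → R w x) × (∃ λ x → V x)
  S-dom (w≺u , V⊆R , inj₁ (x , v , _)) = w≺u , V⊆R , x , v
  S-dom (w≺u , V⊆R , inj₂ g) with g ∅ w≺u
  ... | y , v , _ = w≺u , V⊆R , y , v

  S-refl : ∀ {w u} → R w u → Sw w u (λ x → x ≡ u)
  S-refl w≺u = w≺u , (λ { _ refl → w≺u }) , inj₁ (_ , refl , inj₁ refl)

  S-R : ∀ {w u x} → R w u → R u x → Sw w u (λ y → y ≡ x)
  S-R {w} {u} {x} w≺u u≺x =
    w≺u , (λ { _ refl → R-trans {w} {u} {x} w≺u u≺x }) , inj₁ (_ , refl , inj₂ u≺x)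

  ClauseB-mono : ∀ {w u V Z} → (∀ x → V x → Z x) → ClauseB w u V → ClauseB w u Z
  ClauseB-mono V⊆Z g S p with g S p
  ... | y , v , rest = y , V⊆Z y v , rest

  S-mono : ∀ {w u V Z} → Sw w u V → (∀ x → V x → Z x) → (∀ x → Z x → R w x) → Sw w u Z
  S-mono (w≺u , _ , inj₁ (x , v , ux)) V⊆Z Z⊆R = w≺u , Z⊆R , inj₁ (x , V⊆Z x v , ux)
  S-mono {w} {u} (w≺u , _ , inj₂ g)  V⊆Z Z⊆R = w≺u , Z⊆R , inj₂ (ClauseB-mono {w} {u} V⊆Z g)

  module _ {w u : World} {V : World → Set₁} (Z : (y : World) → V y → World → Set₁)
           (SZ : ∀ y (q : V y) → Sw w y (Z y q)) where

    ⋃Z : World → Set₁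
    ⋃Z x = ∃₂ λ y (q : V y) → Z y q x

    -- Alternative (a) for V: the clause of Z_y at y ∈ Ṙ[u] carries over to u.
    via-ClauseA : ∀ {y} (q : V y) → InṘ u y → ClauseA u ⋃Z ⊎ ClauseB w u ⋃Z
    via-ClauseA {y} q uy with proj₂ (proj₂ (SZ y q))
    ... | inj₁ (z , zz , yz) = inj₁ (z , (y , q , zz) , InṘ-trans {u} {y} {z} uy yz)
    ... | inj₂ g = inj₂ λ S p → lift-witness (g S (≺-InṘ {w = w} {u} {y} uy p))
      where
      lift-witness : ∀ {S} → WitnessB w y (Z y q) S → WitnessB w u ⋃Z S
      lift-witness (z , zz , G , g∈D , occ , pz) =
        z , (y , q , zz) , G , g∈D , Occurs-InṘ {u} {y} uy occ , pz

    -- Alternative (b) for V: a witness y ∈ V is replaced by a witness of Z_y.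
    via-ClauseB : ClauseB w u V → ClauseB w u ⋃Z
    via-ClauseB g S p with g S p
    ... | y , q , G , g∈D , occ , py with proj₂ (proj₂ (SZ y q))
    ...   | inj₁ (z , zz , yz) = z , (y , q , zz) , G , g∈D , occ , ≺-InṘ {w = w} {y} {z} yz py
    ...   | inj₂ g′ with g′ (S ∪[ □ (¬' G) ]) py
    ...     | z , zz , _ , _ , _ , pz =
      z , (y , q , zz) , G , g∈D , occ , ≺-antitone {w = set w} {set z} inj₁ pz

    S-trans : Sw w u V → Sw w u ⋃Z
    S-trans (w≺u , _ , clause) =
      w≺u , (λ { x (y , q , zx) → proj₁ (proj₂ (SZ y q)) x zx }) , combine clause
      where
      combine : ClauseA u V ⊎ ClauseB w u V → ClauseA u ⋃Z ⊎ ClauseB w u ⋃Z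
      combine (inj₁ (y , q , uy)) = via-ClauseA q uy
      combine (inj₂ g)            = inj₂ (via-ClauseB g)

  S-preserves-≺ : ∀ {S w u V} → Prec S (set w) (set u) → Sw w u V →
    ∃ λ x → V x × Prec S (set w) (set x)
  S-preserves-≺ {w = w} {u} p (_ , _ , inj₁ (x , x∈V , ux)) = x , x∈V , ≺-InṘ {w = w} {u} {x} ux p
  S-preserves-≺ {S} {w} p (_ , _ , inj₂ g) with g S p
  ... | y , y∈V , _ , _ , _ , py = y , y∈V , ≺-antitone {w = set w} {set y} inj₁ py

  module Truth (sc : SubClosed D) where

    truth : ∀ G → G ∈ D → ∀ w → w ⊩ G ⇔ set w G
    truth (var n) _ w = mk⇔ lower lift
    truth ⊥'      _ w = mk⇔ (λ ()) (λ b → ⊥-elim (MCS.no-⊥ (mcs w) b))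
    truth (A ⇒ B) A⇒B∈D w = mk⇔ to from
      where
      open MCS (mcs w)
      module A = Equivalence (truth A (proj₁ (proj₁ sc A⇒B∈D)) w)
      module B = Equivalence (truth B (proj₂ (proj₁ sc A⇒B∈D)) w)
      -- If A ⇒ B ∉ w then A ∈ w and ¬B ∈ w, while forcing gives B ∈ w.
      to : (w ⊩ A → w ⊩ B) → set w (A ⇒ B)
      to f = stable λ ∉ → let a , ¬b = ¬⇒-parts (complete ∉) in
        no-contradiction (B.to (f (A.from a))) ¬b
      from : set w (A ⇒ B) → w ⊩ A → w ⊩ B
      from a⇒b a = B.from (infer (a⇒b ∷ A.to a ∷ []) λ { v (a⇒b ∷ a ∷ []) → ⇒-elim a⇒b a })
    truth (A ▷ B) A▷B∈D w = mk⇔ to from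
      where
      open MCS (mcs w)
      A∈D = proj₁ (proj₂ sc A▷B∈D)
      B∈D = proj₂ (proj₂ sc A▷B∈D)
      module A u = Equivalence (truth A A∈D u)
      module B u = Equivalence (truth B B∈D u)
      -- If A ▷ B ∉ w, take an A-successor u with w ≺_{¬B} u: every world in
      -- any V with u S_w V is again ≺_{¬B}-above w, so none forces B.
      to : w ⊩ (A ▷ B) → set w (A ▷ B)
      to forced = stable λ ∉ → no-witness (¬▷-successor (mcs w) (complete ∉))
        where
        escapes : ∀ u → Prec (∅ ∪[ ¬' B ]) (set w) (set u) → set u A → ⊥
        escapes u w≺u a with forced u (≺-antitone {w = set w} {set u} (λ ()) w≺u) (A.from u a)
        ... | V , uSV , V⊩B with S-preserves-≺ {w = w} {u} w≺u uSV
        ... | x , x∈V , w≺x = ≺-excludes (mcs w) (mcs x) w≺x (B.to x (V⊩B x x∈V))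
        no-witness : Successor X (set w) (∅ ∪[ ¬' B ]) A → ⊥
        no-witness (u , mu , a , □¬a , w≺u) = escapes (world u mu A∈D a □¬a) w≺u a
      -- If A ▷ B ∈ w, the B-worlds above w form a V satisfying alternative (b).
      from : set w (A ▷ B) → w ⊩ (A ▷ B)
      from a▷b u w≺u u⊩A =
        V , (w≺u , (λ x → proj₁ ∘ lower) , inj₂ clauseB) , λ x x∈V → B.from x (proj₂ (lower x∈V))
        where
        V : World → Set₁
        V x = Lift (lsuc lzero) (R w x × set x B)
        clauseB : ClauseB w u V
        clauseB S w≺ₛu with ▷-successor (mcs w) (mcs u) a▷b w≺ₛu (A.to u u⊩A)
        ... | y , my , b , □¬b , w≺y =
          world y my B∈D b □¬b , lift (≺-antitone {w = set w} {y} (λ ()) w≺y , b) ,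
          A , A∈D , inj₁ (A.to u u⊩A) , w≺y

  is-GVM : ⊤' ∈ D → IsGVM
  is-GVM ⊤∈D = record
    { inhabited = inhabited ⊤∈D
    ; R-trans   = λ {x} {y} {z} → R-trans {x} {y} {z}
    ; R-cwf     = R-cwf
    ; S-dom     = λ {w} {u} {V} → S-dom {w} {u} {V}
    ; S-refl    = λ {w} {u} → S-refl {w} {u}
    ; S-trans   = λ {w} {u} {V} uSV Z SZ → S-trans {w} {u} {V} Z SZ uSV
    ; S-R       = λ {w} {u} {x} → S-R {w} {u} {x}
    ; S-mono    = λ {w} {u} {V} {Z} → S-mono {w} {u} {V} {Z}
    }

-- The ILX-structure for D is a generalized Veltman model in which forcing and
-- membership agree on D.
mainTheorem17 : (X : ExtX) (D : List Fm) → SubClosed D → NegClosed D → ⊤' ∈ D →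
    Structure.IsGVM X D ×
    (∀ (G : Fm) → G ∈ D → ∀ (w : Structure.World X D) →
      (Structure._⊩_ X D w G ⇔ Structure.World.set w G))
mainTheorem17 X D sc _ ⊤∈D = is-GVM ⊤∈D , truth
  where
  open Canonical X D
  open Truth sc
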